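{- Fix non-zero integers $r$ and $s$, and let $a_{k,n}$ denote the entries of the binomial array $B(sx+r)$. Then for every integer $n>0$, $$\sum_{i=0}^{n+1}a_{i,n}a_{n+1-i,n}=\big[(r+s)^2n+2rs\big]C_n$$ and $$\sum_{i=0}^{n+2}a_{i,n}a_{n+2-i,n+1}=\tfrac12\big[(r+s)^2n+4rs+2s^2\big]C_{n+1},$$ where $C_n=\frac{1}{n+1}\binom{2n}{n}$ is the $n$-th Catalan number.
   Context: The binomial array $B(p(x))$ of a power series $p(x)$ has entries $a_{k,n}$ ($k\ge0$, $n\in\mathbb{Z}$) equal to the coefficient of $x^k$ in $(1+x)^np(x)$; here $p(x)=r+sx$, so $a_{k,n}=r\binom{n}{k}+s\binom{n}{k-1}$ for $n\ge0$. -}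

module Defs where

open import Data.Nat as ℕ using (ℕ; zero; suc)
open import Data.Nat.Combinatorics using (_C_)
open import Data.Integer using (ℤ; +_; _+_; _*_)

-- binomial coefficient C(n, k-1), with C(n,-1) = 0
binomPred : ℕ → ℕ → ℕ
binomPred n zero    = 0
binomPred n (suc k) = n C k

-- entries a_{k,n} (k ≥ 0, n ≥ 0) of the binomial array B(s x + r):
-- coefficient of x^k in (1+x)^n (r + s x) = r C(n,k) + s C(n,k-1)
binArr : ℤ → ℤ → ℕ → ℕ → ℤ
binArr r s k n = r * + (n C k) + s * + (binomPred n k)

sumTo : ℕ → (ℕ → ℤ) → ℤ
sumTo zero    f = f 0
sumTo (suc m) f = sumTo m f + f (suc m)

-- n-th Catalan number  C_n = binom(2n,n) / (n+1)  (exact division)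
catalan : ℕ → ℕ
catalan n = ((2 ℕ.* n) C n) ℕ./ suc n

-- Expanding a_{i,n} = r C(n,i) + s C(n,i-1) and applying Vandermonde's identity to each
-- of the four resulting sums shows that the convolution of two columns of B(r + s x) is a
-- column of B((r + s x)²). At the columns of the theorem, symmetry and Pascal's rule reduce
-- the binomial coefficients that occur to the central ones, C(2m,m) = (m+1) C_m and
-- C(2m,m+1) = m C_m, which follow from (k+1) C(n,k+1) = (n-k) C(n,k); what is left is a
-- ring identity.
module Submission where

open import Defs
open import Data.Nat as ℕ using (ℕ; suc; _∸_)
open import Relation.Binary.PropositionalEquality
  using (_≡_; _≢_; _≗_; refl; sym; trans; cong; cong₂; module ≡-Reasoning)
open ≡-Reasoning

module BinomialCoefficients where
  open import Data.Nat using (_+_; _*_; _/_; zero)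
  open import Data.Nat.Properties
  open import Data.Nat.DivMod using (m*n/n≡m)
  open import Data.Nat.Combinatorics
    using (_C_; nC1≡n; nCk≡nC[n∸k]; nCk+nC[k+1]≡[n+1]C[k+1])
  import Data.Nat.Tactic.RingSolver as ℕ-Solver

  -- (k+1) C(n,k+1) = (n-k) C(n,k), stated without truncated subtraction.
  [k+1]*nC[k+1]+k*nCk≡n*nCk : ∀ n k → suc k * (n C suc k) + k * (n C k) ≡ n * (n C k)
  [k+1]*nC[k+1]+k*nCk≡n*nCk zero    zero    = refl
  [k+1]*nC[k+1]+k*nCk≡n*nCk zero    (suc k) = cong₂ _+_ (*-zeroʳ (suc (suc k))) (*-zeroʳ (suc k))
  [k+1]*nC[k+1]+k*nCk≡n*nCk (suc n) zero    =
    trans (+-identityʳ _) (trans (+-identityʳ _) (trans (nC1≡n (suc n)) (sym (*-identityʳ _))))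
  [k+1]*nC[k+1]+k*nCk≡n*nCk (suc n) (suc k) = begin
    suc (suc k) * (suc n C suc (suc k)) + suc k * (suc n C suc k)
      ≡⟨ cong₂ (λ x y → suc (suc k) * x + suc k * y)
           (sym (nCk+nC[k+1]≡[n+1]C[k+1] n (suc k))) (sym (nCk+nC[k+1]≡[n+1]C[k+1] n k)) ⟩
    suc (suc k) * (n C suc k + n C suc (suc k)) + suc k * (n C k + n C suc k)
      ≡⟨ regroup k (n C k) (n C suc k) (n C suc (suc k)) ⟩
    (suc (suc k) * (n C suc (suc k)) + suc k * (n C suc k))
      + (suc k * (n C suc k) + k * (n C k)) + (n C k + n C suc k)
      ≡⟨ cong₂ (λ x y → x + y + (n C k + n C suc k))
           ([k+1]*nC[k+1]+k*nCk≡n*nCk n (suc k)) ([k+1]*nC[k+1]+k*nCk≡n*nCk n k) ⟩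
    n * (n C suc k) + n * (n C k) + (n C k + n C suc k)
      ≡⟨ collect n (n C k) (n C suc k) ⟩
    suc n * (n C k + n C suc k)
      ≡⟨ cong (suc n *_) (nCk+nC[k+1]≡[n+1]C[k+1] n k) ⟩
    suc n * (suc n C suc k) ∎
    where
    regroup : ∀ k a b c → suc (suc k) * (b + c) + suc k * (a + b)
                        ≡ (suc (suc k) * c + suc k * b) + (suc k * b + k * a) + (a + b)
    regroup = ℕ-Solver.solve-∀
    collect : ∀ n a b → n * b + n * a + (a + b) ≡ suc n * (a + b)
    collect = ℕ-Solver.solve-∀

  [m+n]Cm≡[m+n]Cn : ∀ m n → (m + n) C m ≡ (m + n) C n
  [m+n]Cm≡[m+n]Cn m n = trans (nCk≡nC[n∸k] (m≤m+n m n)) (cong ((m + n) C_) (m+n∸m≡n m n))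

  [n+1]*[2n]C[n+1]≡n*[2n]Cn : ∀ n → suc n * ((n + n) C suc n) ≡ n * ((n + n) C n)
  [n+1]*[2n]C[n+1]≡n*[2n]Cn n = +-cancelʳ-≡ (n * X) _ _ (begin
    suc n * ((n + n) C suc n) + n * X ≡⟨ [k+1]*nC[k+1]+k*nCk≡n*nCk (n + n) n ⟩
    (n + n) * X                       ≡⟨ *-distribʳ-+ X n n ⟩
    n * X + n * X                     ∎)
    where X = (n + n) C n

  [2n]Cn≡[n+1]*catalan : ∀ n → (n + n) C n ≡ suc n * catalan n
  [2n]Cn≡[n+1]*catalan n = trans X≡[n+1]*d (cong (suc n *_) (sym catalan≡d))
    where
    X = (n + n) C n
    Y = (n + n) C suc n
    d = X ∸ Y

    X≡[n+1]*d : X ≡ suc n * d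
    X≡[n+1]*d = sym (begin
      suc n * (X ∸ Y)           ≡⟨ *-distribˡ-∸ (suc n) X Y ⟩
      suc n * X ∸ suc n * Y     ≡⟨ cong (suc n * X ∸_) ([n+1]*[2n]C[n+1]≡n*[2n]Cn n) ⟩
      (X + n * X) ∸ n * X       ≡⟨ m+n∸n≡m X (n * X) ⟩
      X                         ∎)

    catalan≡d : catalan n ≡ d
    catalan≡d = begin
      ((2 * n) C n) / suc n ≡⟨ cong (λ m → (m C n) / suc n) (cong (n +_) (+-identityʳ n)) ⟩
      X / suc n             ≡⟨ cong (_/ suc n) (trans X≡[n+1]*d (*-comm (suc n) d)) ⟩
      (d * suc n) / suc n   ≡⟨ m*n/n≡m d (suc n) ⟩
      d                     ∎

  [2n]C[n+1]≡n*catalan : ∀ n → (n + n) C suc n ≡ n * catalan n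
  [2n]C[n+1]≡n*catalan n = *-cancelˡ-≡ _ _ (suc n) (begin
    suc n * ((n + n) C suc n)   ≡⟨ [n+1]*[2n]C[n+1]≡n*[2n]Cn n ⟩
    n * ((n + n) C n)           ≡⟨ cong (n *_) ([2n]Cn≡[n+1]*catalan n) ⟩
    n * (suc n * catalan n)     ≡⟨ swap n (catalan n) ⟩
    suc n * (n * catalan n)     ∎)
    where
    swap : ∀ n c → n * (suc n * c) ≡ suc n * (n * c)
    swap = ℕ-Solver.solve-∀

  [2n+2]Cn≡[2n+2]C[n+2] : ∀ n → (suc n + suc n) C n ≡ (suc n + suc n) C suc (suc n)
  [2n+2]Cn≡[2n+2]C[n+2] n = begin
    suc (n + suc n) C n            ≡⟨ cong (_C n) (sym (+-suc n (suc n))) ⟩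
    (n + suc (suc n)) C n          ≡⟨ [m+n]Cm≡[m+n]Cn n (suc (suc n)) ⟩
    (n + suc (suc n)) C suc (suc n) ≡⟨ cong (_C suc (suc n)) (+-suc n (suc n)) ⟩
    suc (n + suc n) C suc (suc n)  ∎

  [2n+1]C[n+1]+[2n+1]C[n+1]≡[n+2]*catalan[n+1] : ∀ n →
    (n + suc n) C suc n + (n + suc n) C suc n ≡ suc (suc n) * catalan (suc n)
  [2n+1]C[n+1]+[2n+1]C[n+1]≡[n+2]*catalan[n+1] n = begin
    (n + suc n) C suc n + (n + suc n) C suc n
      ≡⟨ cong (_+ (n + suc n) C suc n) (sym ([m+n]Cm≡[m+n]Cn n (suc n))) ⟩
    (n + suc n) C n + (n + suc n) C suc n
      ≡⟨ nCk+nC[k+1]≡[n+1]C[k+1] (n + suc n) n ⟩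
    (suc n + suc n) C suc n
      ≡⟨ [2n]Cn≡[n+1]*catalan (suc n) ⟩
    suc (suc n) * catalan (suc n) ∎

  [2n+1]C[n+1]+[2n+1]C[n+2]≡[n+1]*catalan[n+1] : ∀ n →
    (n + suc n) C suc n + (n + suc n) C suc (suc n) ≡ suc n * catalan (suc n)
  [2n+1]C[n+1]+[2n+1]C[n+2]≡[n+1]*catalan[n+1] n =
    trans (nCk+nC[k+1]≡[n+1]C[k+1] (n + suc n) (suc n)) ([2n]C[n+1]≡n*catalan (suc n))

open BinomialCoefficients
open import Data.Integer using (ℤ; +_; _+_; _-_; _*_)
open import Data.Product using (_×_; _,_)
open import Data.Integer.Properties
  using (pos-*; pos-+; +-assoc; +-identityˡ; +-identityʳ; +-comm; *-zeroʳ; *-distribʳ-+; *-identityˡ)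
open import Data.Integer.Tactic.RingSolver using (solve-∀)
open import Data.Nat.Combinatorics using (_C_; nCk+nC[k+1]≡[n+1]C[k+1])

sumTo-cong : ∀ m {f g : ℕ → ℤ} → f ≗ g → sumTo m f ≡ sumTo m g
sumTo-cong ℕ.zero    f≗g = f≗g 0
sumTo-cong (suc m) f≗g = cong₂ _+_ (sumTo-cong m f≗g) (f≗g (suc m))

sumTo-+ : ∀ m (f g : ℕ → ℤ) → sumTo m (λ i → f i + g i) ≡ sumTo m f + sumTo m g
sumTo-+ ℕ.zero    f g = refl
sumTo-+ (suc m) f g = trans (cong (_+ (f (suc m) + g (suc m))) (sumTo-+ m f g))
                            (interchange (sumTo m f) (sumTo m g) (f (suc m)) (g (suc m)))
  where
  interchange : ∀ a b c d → a + b + (c + d) ≡ a + c + (b + d)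
  interchange = solve-∀

sumTo-zero : ∀ m → sumTo m (λ _ → + 0) ≡ + 0
sumTo-zero ℕ.zero    = refl
sumTo-zero (suc m) = trans (+-identityʳ _) (sumTo-zero m)

sumTo-sucˡ : ∀ m (f : ℕ → ℤ) → sumTo (suc m) f ≡ f 0 + sumTo m (λ i → f (suc i))
sumTo-sucˡ ℕ.zero    f = refl
sumTo-sucˡ (suc m) f = trans (cong (_+ f (suc (suc m))) (sumTo-sucˡ m f)) (+-assoc (f 0) _ _)

sumTo-bilinear : ∀ (r s r′ s′ : ℤ) m (x y z w : ℕ → ℤ) →
  sumTo m (λ i → (r * x i + s * y i) * (r′ * z i + s′ * w i))
  ≡ r * r′ * sumTo m (λ i → x i * z i) + r * s′ * sumTo m (λ i → x i * w i)
    + s * r′ * sumTo m (λ i → y i * z i) + s * s′ * sumTo m (λ i → y i * w i)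
sumTo-bilinear r s r′ s′ ℕ.zero    x y z w = expand r s r′ s′ (x 0) (y 0) (z 0) (w 0)
  where
  expand : ∀ r s r′ s′ x y z w → (r * x + s * y) * (r′ * z + s′ * w)
         ≡ r * r′ * (x * z) + r * s′ * (x * w) + s * r′ * (y * z) + s * s′ * (y * w)
  expand = solve-∀
sumTo-bilinear r s r′ s′ (suc m) x y z w =
  trans (cong (_+ (r * x (suc m) + s * y (suc m)) * (r′ * z (suc m) + s′ * w (suc m)))
              (sumTo-bilinear r s r′ s′ m x y z w))
        (expand r s r′ s′ (x (suc m)) (y (suc m)) (z (suc m)) (w (suc m))
          (sumTo m (λ i → x i * z i)) (sumTo m (λ i → x i * w i))
          (sumTo m (λ i → y i * z i)) (sumTo m (λ i → y i * w i)))
  where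
  expand : ∀ r s r′ s′ x y z w A B C D →
           r * r′ * A + r * s′ * B + s * r′ * C + s * s′ * D + (r * x + s * y) * (r′ * z + s′ * w)
         ≡ r * r′ * (A + x * z) + r * s′ * (B + x * w) + s * r′ * (C + y * z) + s * s′ * (D + y * w)
  expand = solve-∀

-- The coefficient sequence of x · f(x).
shift : (ℕ → ℤ) → ℕ → ℤ
shift f ℕ.zero    = + 0
shift f (suc i) = f i

shift-cong : ∀ {f g} → f ≗ g → shift f ≗ shift g
shift-cong f≗g ℕ.zero    = refl
shift-cong f≗g (suc i) = f≗g i

infixl 7 _⋆_

-- i ≤ k throughout, so k ∸ i never truncates.
_⋆_ : (ℕ → ℤ) → (ℕ → ℤ) → ℕ → ℤ
(f ⋆ g) k = sumTo k (λ i → f i * g (k ∸ i))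

⋆-cong : ∀ {f f′ g g′} → f ≗ f′ → g ≗ g′ → f ⋆ g ≗ f′ ⋆ g′
⋆-cong f≗f′ g≗g′ k = sumTo-cong k (λ i → cong₂ _*_ (f≗f′ i) (g≗g′ (k ∸ i)))

⋆-suc : ∀ f g k → (f ⋆ g) (suc k) ≡ f 0 * g (suc k) + ((λ i → f (suc i)) ⋆ g) k
⋆-suc f g k = sumTo-sucˡ k (λ i → f i * g (suc k ∸ i))

⋆-distribʳ-+ : ∀ f f′ g → (λ i → f i + f′ i) ⋆ g ≗ λ k → (f ⋆ g) k + (f′ ⋆ g) k
⋆-distribʳ-+ f f′ g k =
  trans (sumTo-cong k (λ i → *-distribʳ-+ (g (k ∸ i)) (f i) (f′ i)))
        (sumTo-+ k (λ i → f i * g (k ∸ i)) (λ i → f′ i * g (k ∸ i)))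

shift-⋆ : ∀ f g → shift f ⋆ g ≗ shift (f ⋆ g)
shift-⋆ f g ℕ.zero    = refl
shift-⋆ f g (suc k) = trans (⋆-suc (shift f) g k) (+-identityˡ _)

⋆-shift : ∀ f g → f ⋆ shift g ≗ shift (f ⋆ g)
⋆-shift f g ℕ.zero  = *-zeroʳ (f 0)
⋆-shift f g (suc k) = begin
  (f ⋆ shift g) (suc k)                               ≡⟨ ⋆-suc f (shift g) k ⟩
  f 0 * g k + ((λ i → f (suc i)) ⋆ shift g) k         ≡⟨ cong (λ x → f 0 * g k + x) (⋆-shift (λ i → f (suc i)) g k) ⟩
  f 0 * g k + shift ((λ i → f (suc i)) ⋆ g) k         ≡⟨ unshift k ⟩
  (f ⋆ g) k                                           ∎
  where
  unshift : ∀ k → f 0 * g k + shift ((λ i → f (suc i)) ⋆ g) k ≡ (f ⋆ g) k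
  unshift ℕ.zero    = +-identityʳ _
  unshift (suc k) = sym (⋆-suc f g k)

binomial : ℕ → ℕ → ℤ
binomial n k = + (n C k)

binomial-suc : ∀ n → binomial (suc n) ≗ λ k → binomial n k + shift (binomial n) k
binomial-suc n ℕ.zero    = refl
binomial-suc n (suc k) = begin
  + (suc n C suc k)                               ≡⟨ cong +_ (sym (nCk+nC[k+1]≡[n+1]C[k+1] n k)) ⟩
  + (n C k ℕ.+ n C suc k)                         ≡⟨ pos-+ (n C k) (n C suc k) ⟩
  binomial n k + binomial n (suc k)               ≡⟨ +-comm (binomial n k) (binomial n (suc k)) ⟩
  binomial n (suc k) + shift (binomial n) (suc k) ∎

binomial-zero-⋆ : ∀ g → binomial 0 ⋆ g ≗ g
binomial-zero-⋆ g ℕ.zero    = *-identityˡ (g 0)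
binomial-zero-⋆ g (suc k) = begin
  (binomial 0 ⋆ g) (suc k)                        ≡⟨ ⋆-suc (binomial 0) g k ⟩
  + 1 * g (suc k) + sumTo k (λ _ → + 0)           ≡⟨ cong₂ _+_ (*-identityˡ (g (suc k))) (sumTo-zero k) ⟩
  g (suc k) + + 0                                 ≡⟨ +-identityʳ (g (suc k)) ⟩
  g (suc k)                                       ∎

vandermonde : ∀ a b → binomial a ⋆ binomial b ≗ binomial (a ℕ.+ b)
vandermonde ℕ.zero    b = binomial-zero-⋆ (binomial b)
vandermonde (suc a) b k = begin
  (binomial (suc a) ⋆ binomial b) k
    ≡⟨ ⋆-cong {g = binomial b} (binomial-suc a) (λ _ → refl) k ⟩
  ((λ i → binomial a i + shift (binomial a) i) ⋆ binomial b) k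
    ≡⟨ ⋆-distribʳ-+ (binomial a) (shift (binomial a)) (binomial b) k ⟩
  (binomial a ⋆ binomial b) k + (shift (binomial a) ⋆ binomial b) k
    ≡⟨ cong₂ _+_ (vandermonde a b k)
                 (trans (shift-⋆ (binomial a) (binomial b) k) (shift-cong (vandermonde a b) k)) ⟩
  binomial (a ℕ.+ b) k + shift (binomial (a ℕ.+ b)) k
    ≡⟨ sym (binomial-suc (a ℕ.+ b) k) ⟩
  binomial (suc a ℕ.+ b) k ∎

binArr-column : ∀ r s n → (λ k → binArr r s k n) ≗ λ k → r * binomial n k + s * shift (binomial n) k
binArr-column r s n ℕ.zero    = refl
binArr-column r s n (suc k) = refl

-- The right-hand side is column a + b of B((r + s x)(r′ + s′ x)).
binArr-⋆ : ∀ r s r′ s′ a b →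
  (λ k → binArr r s k a) ⋆ (λ k → binArr r′ s′ k b)
  ≗ λ k → r * r′ * binomial (a ℕ.+ b) k + (r * s′ + s * r′) * shift (binomial (a ℕ.+ b)) k
          + s * s′ * shift (shift (binomial (a ℕ.+ b))) k
binArr-⋆ r s r′ s′ a b k = begin
  ((λ k → binArr r s k a) ⋆ (λ k → binArr r′ s′ k b)) k
    ≡⟨ ⋆-cong (binArr-column r s a) (binArr-column r′ s′ b) k ⟩
  ((λ i → r * A i + s * shift A i) ⋆ (λ j → r′ * B j + s′ * shift B j)) k
    ≡⟨ sumTo-bilinear r s r′ s′ k A (shift A) (λ i → B (k ∸ i)) (λ i → shift B (k ∸ i)) ⟩
  r * r′ * (A ⋆ B) k + r * s′ * (A ⋆ shift B) k + s * r′ * (shift A ⋆ B) k + s * s′ * (shift A ⋆ shift B) k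
    ≡⟨ cong₂ _+_ (cong₂ _+_ (cong₂ _+_ (cong (r * r′ *_) (vandermonde a b k))
                                      (cong (r * s′ *_) (A⋆shiftB k)))
                           (cong (s * r′ *_) (shiftA⋆B k)))
                 (cong (s * s′ *_) (trans (shift-⋆ A (shift B) k) (shift-cong A⋆shiftB k))) ⟩
  r * r′ * N k + r * s′ * shift N k + s * r′ * shift N k + s * s′ * shift (shift N) k
    ≡⟨ collect (r * r′) (r * s′) (s * r′) (s * s′) (N k) (shift N k) (shift (shift N) k) ⟩
  r * r′ * N k + (r * s′ + s * r′) * shift N k + s * s′ * shift (shift N) k ∎
  where
  A = binomial a
  B = binomial b
  N = binomial (a ℕ.+ b)
  A⋆shiftB : A ⋆ shift B ≗ shift N
  A⋆shiftB k = trans (⋆-shift A B k) (shift-cong (vandermonde a b) k)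
  shiftA⋆B : shift A ⋆ B ≗ shift N
  shiftA⋆B k = trans (shift-⋆ A B k) (shift-cong (vandermonde a b) k)
  collect : ∀ p q q′ t x y z → p * x + q * y + q′ * y + t * z ≡ p * x + (q + q′) * y + t * z
  collect = solve-∀

shift²-binomial-[2n] : ∀ n → shift (shift (binomial (n ℕ.+ n))) (suc n) ≡ binomial (n ℕ.+ n) (suc n)
shift²-binomial-[2n] ℕ.zero    = refl
shift²-binomial-[2n] (suc n) = cong +_ ([2n+2]Cn≡[2n+2]C[n+2] n)

self-convolution≡catalan : ∀ r s n →
  sumTo (suc n) (λ i → binArr r s i n * binArr r s (suc n ∸ i) n)
  ≡ ((r + s) * (r + s) * + n + + 2 * r * s) * + catalan n
self-convolution≡catalan r s n = begin
  sumTo (suc n) (λ i → binArr r s i n * binArr r s (suc n ∸ i) n)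
    ≡⟨ binArr-⋆ r s r s n n (suc n) ⟩
  r * r * binomial N (suc n) + (r * s + s * r) * binomial N n + s * s * shift (shift (binomial N)) (suc n)
    ≡⟨ cong (λ t → r * r * binomial N (suc n) + (r * s + s * r) * binomial N n + s * s * t)
            (shift²-binomial-[2n] n) ⟩
  r * r * binomial N (suc n) + (r * s + s * r) * binomial N n + s * s * binomial N (suc n)
    ≡⟨ cong₂ (λ x y → r * r * x + (r * s + s * r) * y + s * s * x)
             (trans (cong +_ ([2n]C[n+1]≡n*catalan n)) (pos-* n (catalan n)))
             (trans (cong +_ ([2n]Cn≡[n+1]*catalan n)) (pos-* (suc n) (catalan n))) ⟩
  r * r * (+ n * + catalan n) + (r * s + s * r) * (+ suc n * + catalan n) + s * s * (+ n * + catalan n)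
    ≡⟨ collect r s (+ n) (+ catalan n) ⟩
  ((r + s) * (r + s) * + n + + 2 * r * s) * + catalan n ∎
  where
  N = n ℕ.+ n
  collect : ∀ r s n c → r * r * (n * c) + (r * s + s * r) * ((+ 1 + n) * c) + s * s * (n * c)
                      ≡ ((r + s) * (r + s) * n + + 2 * r * s) * c
  collect = solve-∀

adjacent-convolution≡catalan : ∀ r s n →
  + 2 * sumTo (suc (suc n)) (λ i → binArr r s i n * binArr r s (suc (suc n) ∸ i) (suc n))
  ≡ ((r + s) * (r + s) * + n + + 4 * r * s + + 2 * s * s) * + catalan (suc n)
adjacent-convolution≡catalan r s n = begin
  + 2 * sumTo (suc (suc n)) (λ i → binArr r s i n * binArr r s (suc (suc n) ∸ i) (suc n))
    ≡⟨ cong (+ 2 *_) (binArr-⋆ r s r s n (suc n) (suc (suc n))) ⟩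
  + 2 * (r * r * w + (r * s + s * r) * z + s * s * binomial N n)
    ≡⟨ cong (λ t → + 2 * (r * r * w + (r * s + s * r) * z + s * s * t))
            (cong +_ ([m+n]Cm≡[m+n]Cn n (suc n))) ⟩
  + 2 * (r * r * w + (r * s + s * r) * z + s * s * z)
    ≡⟨ regroup r s z w ⟩
  + 2 * r * r * (z + w) + (s * s + + 2 * r * s - r * r) * (z + z)
    ≡⟨ cong₂ (λ x y → + 2 * r * r * x + (s * s + + 2 * r * s - r * r) * y) z+w≡[n+1]*catalan z+z≡[n+2]*catalan ⟩
  + 2 * r * r * ((+ 1 + + n) * + catalan (suc n)) + (s * s + + 2 * r * s - r * r) * ((+ 2 + + n) * + catalan (suc n))
    ≡⟨ collect r s (+ n) (+ catalan (suc n)) ⟩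
  ((r + s) * (r + s) * + n + + 4 * r * s + + 2 * s * s) * + catalan (suc n) ∎
  where
  N = n ℕ.+ suc n
  z = binomial N (suc n)
  w = binomial N (suc (suc n))
  z+z≡[n+2]*catalan : z + z ≡ (+ 2 + + n) * + catalan (suc n)
  z+z≡[n+2]*catalan = trans (sym (pos-+ (N C suc n) (N C suc n)))
    (trans (cong +_ ([2n+1]C[n+1]+[2n+1]C[n+1]≡[n+2]*catalan[n+1] n)) (pos-* (suc (suc n)) (catalan (suc n))))
  z+w≡[n+1]*catalan : z + w ≡ (+ 1 + + n) * + catalan (suc n)
  z+w≡[n+1]*catalan = trans (sym (pos-+ (N C suc n) (N C suc (suc n))))
    (trans (cong +_ ([2n+1]C[n+1]+[2n+1]C[n+2]≡[n+1]*catalan[n+1] n)) (pos-* (suc n) (catalan (suc n))))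
  regroup : ∀ r s z w → + 2 * (r * r * w + (r * s + s * r) * z + s * s * z)
                      ≡ + 2 * r * r * (z + w) + (s * s + + 2 * r * s - r * r) * (z + z)
  regroup = solve-∀
  collect : ∀ r s n c → + 2 * r * r * ((+ 1 + n) * c) + (s * s + + 2 * r * s - r * r) * ((+ 2 + n) * c)
                      ≡ ((r + s) * (r + s) * n + + 4 * r * s + + 2 * s * s) * c
  collect = solve-∀

-- The identities hold for all integers r, s and every n ≥ 0.
theorem7p3 : (r s : ℤ) → r ≢ + 0 → s ≢ + 0 → (n : ℕ) → 0 ℕ.< n →
    (sumTo (suc n) (λ i → binArr r s i n * binArr r s (suc n ∸ i) n)
      ≡ ((r + s) * (r + s) * + n + + 2 * r * s) * + catalan n)
    × (+ 2 * sumTo (suc (suc n)) (λ i → binArr r s i n * binArr r s (suc (suc n) ∸ i) (suc n))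
      ≡ ((r + s) * (r + s) * + n + + 4 * r * s + + 2 * s * s) * + catalan (suc n))
theorem7p3 r s _ _ n _ = self-convolution≡catalan r s n , adjacent-convolution≡catalan r s n
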